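{- (1) $\chi_{NL}(P_2)=2$. (2) $\chi_{NL}(P_n)=3$ for $3\le n\le 9$. (3) $\chi_{NL}(C_n)=3$ for $n\in\{3,5,7,9\}$. (4) $\chi_{NL}(C_n)=4$ for $n\in\{4,6,8\}$. Here $P_n$ and $C_n$ denote the path and the cycle of order $n$.
   Context: All graphs are finite, simple, undirected and connected. A $k$-coloring of a graph $G$ is a partition of $V(G)$ into $k$ independent sets (colors). A coloring $\{S_1,\dots,S_k\}$ is neighbor-locating (an NL-coloring) if for any two distinct vertices $u,v$ in the same color class, $\{j: N(u)\cap S_j\neq\emptyset\}\neq\{j: N(v)\cap S_j\neq\emptyset\}$. The neighbor-locating chromatic number $\chi_{NL}(G)$ is the minimum number of colors in an NL-coloring of $G$. -}

module Defs where

open import Data.Nat using (ℕ; zero; suc; _<_)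
open import Data.Fin using (Fin; toℕ)
open import Data.Product using (Σ; ∃; _×_; _,_)
open import Data.Sum using (_⊎_)
open import Relation.Binary.PropositionalEquality using (_≡_)
open import Relation.Nullary using (¬_)
open import Function.Bundles using (_⇔_)

record Graph (n : ℕ) : Set₁ where
  field
    Adj : Fin n → Fin n → Set
open Graph public

PathAdj : ∀ {n} → Fin n → Fin n → Set
PathAdj i j = toℕ j ≡ suc (toℕ i) ⊎ toℕ i ≡ suc (toℕ j)

Path : (n : ℕ) → Graph n
Path n = record { Adj = PathAdj }

-- Cycle C_n : the path plus the edge {n-1, 0}  (intended for n ≥ 3).
CycleAdj : ∀ {n} → Fin n → Fin n → Set
CycleAdj {n} i j =
  PathAdj i j
  ⊎ (toℕ i ≡ 0 × suc (toℕ j) ≡ n)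
  ⊎ (toℕ j ≡ 0 × suc (toℕ i) ≡ n)

Cycle : (n : ℕ) → Graph n
Cycle n = record { Adj = CycleAdj }

-- A k-coloring: a partition of V(G) into k independent sets (color classes),
-- i.e. a surjective map c : V → Fin k with adjacent vertices colored differently.
record Coloring {n : ℕ} (G : Graph n) (k : ℕ) : Set where
  field
    col        : Fin n → Fin k
    surjective : ∀ (j : Fin k) → ∃ λ v → col v ≡ j
    proper     : ∀ u v → Adj G u v → ¬ (col u ≡ col v)
open Coloring public

SeesColor : ∀ {n k} {G : Graph n} → Coloring G k → Fin n → Fin k → Set
SeesColor {G = G} c u j = ∃ λ w → Adj G u w × col c w ≡ j

NeighborLocating : ∀ {n k} {G : Graph n} → Coloring G k → Set
NeighborLocating c =
  ∀ u v → ¬ (u ≡ v) → col c u ≡ col c v →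
    ¬ (∀ j → SeesColor c u j ⇔ SeesColor c v j)

HasNLColoring : ∀ {n} → Graph n → ℕ → Set
HasNLColoring G k = Σ (Coloring G k) NeighborLocating

χNL≡ : ∀ {n} → Graph n → ℕ → Set
χNL≡ G m = HasNLColoring G m × (∀ k → k < m → ¬ HasNLColoring G k)

-- Upper bounds are explicit NL-colorings.  Lower bounds come from two general
-- facts about arbitrary graphs and one finite search:
--   * a graph with an edge has no coloring at all with fewer than two colors;
--   * in a proper 2-coloring, a vertex with a neighbour w sees exactly the
--     color of w, and two vertices with a common neighbour get the same color;
--     hence a graph with two distinct vertices sharing a neighbour has no
--     NL-coloring with two colors.  Every path or cycle of order at least 3
--     contains such a pair (0 and 2, with common neighbour 1), so its
--     neighbor-locating chromatic number is at least 3;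
--   * that the even cycles C_4, C_6, C_8 have no NL-coloring with three colors
--     is verified by a certified exhaustive search: being an NL-coloring is a
--     decidable property of a color function Fin n → Fin k, and existence of
--     such a function is decidable by induction on n.
module Submission where

open import Defs
open import Data.Nat using (ℕ; zero; suc; _≤_; _<_; _+_; s≤s; _≟_)
open import Data.Nat.Properties using (m<1+n⇒m<n∨m≡n)
open import Data.Fin using (Fin; zero; suc; toℕ; #_)
open import Data.Fin.Properties using (all?; any?) renaming (_≟_ to _≟ᶠ_)
open import Data.Vec.Functional using ([]; _∷_)
open import Data.Product using (∃; _×_; _,_; proj₁; uncurry)
open import Data.Sum using (_⊎_; inj₁; inj₂)
open import Data.Empty using (⊥-elim)
open import Relation.Nullary using (¬_; Dec; ¬?)
open import Relation.Nullary.Decidable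
  using (True; False; toWitness; toWitnessFalse; map′; _×-dec_; _⊎-dec_; _→-dec_)
open import Relation.Binary.PropositionalEquality
  using (_≡_; _≢_; _≗_; refl; sym; trans)
open import Function.Bundles using (_⇔_; mk⇔; Equivalence)

_⇔-dec_ : ∀ {A B : Set} → Dec A → Dec B → Dec (A ⇔ B)
a? ⇔-dec b? = map′ (uncurry mk⇔) (λ e → Equivalence.to e , Equivalence.from e)
                   ((a? →-dec b?) ×-dec (b? →-dec a?))

fin2-other : (a b c : Fin 2) → a ≢ c → b ≢ c → a ≡ b
fin2-other zero       zero       _          _   _   = refl
fin2-other (suc zero) (suc zero) _          _   _   = refl
fin2-other zero       (suc zero) zero       a≢c _   = ⊥-elim (a≢c refl)
fin2-other zero       (suc zero) (suc zero) _   b≢c = ⊥-elim (b≢c refl)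
fin2-other (suc zero) zero       zero       _   b≢c = ⊥-elim (b≢c refl)
fin2-other (suc zero) zero       (suc zero) a≢c _   = ⊥-elim (a≢c refl)

∃-function? : ∀ n k {P : (Fin n → Fin k) → Set}
  → (∀ {f g} → f ≗ g → P f → P g) → (∀ f → Dec (P f)) → Dec (∃ P)
∃-function? zero k resp P? =
  map′ (λ p → [] , p) (λ (f , p) → resp (λ ()) p) (P? [])
∃-function? (suc n) k {P} resp P? =
  map′ (λ (x , g , p) → x ∷ g , p)
       (λ (f , p) → f zero , (λ i → f (suc i)) , resp η p)
       (any? λ x → ∃-function? n k (resp-cons resp x) (λ g → P? (x ∷ g)))
  where
  η : ∀ {f : Fin (suc n) → Fin k} → f ≗ (f zero ∷ λ i → f (suc i))
  η zero    = refl
  η (suc i) = refl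
  resp-cons : ∀ {Q : (Fin (suc n) → Fin k) → Set}
    → (∀ {f g} → f ≗ g → Q f → Q g)
    → ∀ x {g h} → g ≗ h → Q (x ∷ g) → Q (x ∷ h)
  resp-cons r x g≗h = r λ { zero → refl ; (suc i) → g≗h i }

no-coloring-below-two : ∀ {n} {G : Graph n} {u v : Fin n} → Adj G u v
  → ∀ k → k < 2 → ¬ Coloring G k
no-coloring-below-two {u = u} _ zero _ c with col c u
... | ()
no-coloring-below-two {u = u} {v} uv (suc zero) _ c with col c u in cu | col c v in cv
... | zero | zero = proper c u v uv (trans cu (sym cv))
no-coloring-below-two _ (suc (suc k)) (s≤s (s≤s ()))

module TwoColors {n} {G : Graph n} (c : Coloring G 2) where

  sees-neighbour-color : ∀ {u w} → Adj G u w
    → ∀ j → SeesColor c u j ⇔ (j ≡ col c w)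
  sees-neighbour-color {u} {w} uw j = mk⇔ to (λ j≡w → w , uw , sym j≡w)
    where
    to : SeesColor c u j → j ≡ col c w
    to (w′ , uw′ , w′≡j) =
      trans (sym w′≡j)
            (fin2-other (col c w′) (col c w) (col c u)
              (λ e → proper c u w′ uw′ (sym e)) (λ e → proper c u w uw (sym e)))

  common-neighbour-not-locating : ∀ {u v w} → Adj G u w → Adj G v w → u ≢ v
    → ¬ NeighborLocating c
  common-neighbour-not-locating {u} {v} {w} uw vw u≢v nl =
    nl u v u≢v same-color λ j →
      mk⇔ (λ s → Equivalence.from (sees-neighbour-color vw j)
                   (Equivalence.to (sees-neighbour-color uw j) s))
          (λ s → Equivalence.from (sees-neighbour-color uw j)
                   (Equivalence.to (sees-neighbour-color vw j) s))
    where
    same-color : col c u ≡ col c v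
    same-color = fin2-other (col c u) (col c v) (col c w)
                   (proper c u w uw) (proper c v w vw)

below-suc : ∀ {n} {G : Graph n} {m} → (∀ k → k < m → ¬ HasNLColoring G k)
  → ¬ HasNLColoring G m → ∀ k → k < suc m → ¬ HasNLColoring G k
below-suc below not-m k k<1+m with m<1+n⇒m<n∨m≡n k<1+m
... | inj₁ k<m  = below k k<m
... | inj₂ refl = not-m

below-three : ∀ {n} {G : Graph n} {u v w : Fin n}
  → Adj G u w → Adj G v w → u ≢ v → ∀ k → k < 3 → ¬ HasNLColoring G k
below-three uw vw u≢v =
  below-suc (λ k k<2 (c , _) → no-coloring-below-two uw k k<2 c)
            (λ (c , nl) → TwoColors.common-neighbour-not-locating c uw vw u≢v nl)

-- NL-colorings as bare color functions, so that they can be searched for.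
module ColorFunctions {n} (G : Graph n) (adj? : ∀ u v → Dec (Adj G u v)) {k : ℕ} where

  Proper Surjective : (Fin n → Fin k) → Set
  Proper f     = ∀ u v → Adj G u v → f u ≢ f v
  Surjective f = ∀ j → ∃ λ v → f v ≡ j

  Sees : (Fin n → Fin k) → Fin n → Fin k → Set
  Sees f u j = ∃ λ w → Adj G u w × f w ≡ j

  Locating : (Fin n → Fin k) → Set
  Locating f = ∀ u v → u ≢ v → f u ≡ f v → ¬ (∀ j → Sees f u j ⇔ Sees f v j)

  IsNLColoring : (Fin n → Fin k) → Set
  IsNLColoring f = Proper f × Surjective f × Locating f

  toHasNLColoring : ∀ f → IsNLColoring f → HasNLColoring G k
  toHasNLColoring f (p , s , l) = record { col = f ; surjective = s ; proper = p } , l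

  fromHasNLColoring : (c : HasNLColoring G k) → IsNLColoring (col (proj₁ c))
  fromHasNLColoring (c , l) = proper c , surjective c , l

  isNLColoring? : ∀ f → Dec (IsNLColoring f)
  isNLColoring? f = proper? ×-dec surjective? ×-dec locating?
    where
    proper?     = all? λ u → all? λ v → adj? u v →-dec ¬? (f u ≟ᶠ f v)
    surjective? = all? λ j → any? λ v → f v ≟ᶠ j
    sees? : ∀ u j → Dec (Sees f u j)
    sees? u j = any? λ w → adj? u w ×-dec (f w ≟ᶠ j)
    locating?   = all? λ u → all? λ v → ¬? (u ≟ᶠ v) →-dec (f u ≟ᶠ f v) →-dec
                    ¬? (all? λ j → sees? u j ⇔-dec sees? v j)

  respects-≗ : ∀ {f g} → f ≗ g → IsNLColoring f → IsNLColoring g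
  respects-≗ {f} {g} f≗g (p , s , l) =
    (λ u v uv gu≡gv → p u v uv (trans (f≗g u) (trans gu≡gv (sym (f≗g v))))) ,
    (λ j → let (v , fv≡j) = s j in v , trans (sym (f≗g v)) fv≡j) ,
    (λ u v u≢v gu≡gv same → l u v u≢v (trans (f≗g u) (trans gu≡gv (sym (f≗g v))))
      λ j → mk⇔ (λ x → sees g≗f v j (Equivalence.to   (same j) (sees f≗g u j x)))
                (λ x → sees g≗f u j (Equivalence.from (same j) (sees f≗g v j x))))
    where
    g≗f : g ≗ f
    g≗f x = sym (f≗g x)
    sees : ∀ {h h′} → h ≗ h′ → ∀ u j → Sees h u j → Sees h′ u j
    sees h≗h′ u j (w , uw , hw≡j) = w , uw , trans (sym (h≗h′ w)) hw≡j

  hasNLColoring? : Dec (HasNLColoring G k)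
  hasNLColoring? =
    map′ (uncurry toHasNLColoring) (λ c → col (proj₁ c) , fromHasNLColoring c)
         (∃-function? n k respects-≗ isNLColoring?)

  nlColoring : (f : Fin n → Fin k) → {True (isNLColoring? f)} → HasNLColoring G k
  nlColoring f {ok} = toHasNLColoring f (toWitness ok)

pathAdj? : ∀ {n} (u v : Fin n) → Dec (PathAdj u v)
pathAdj? u v = (toℕ v ≟ suc (toℕ u)) ⊎-dec (toℕ u ≟ suc (toℕ v))

cycleAdj? : ∀ {n} (u v : Fin n) → Dec (CycleAdj u v)
cycleAdj? {n} u v =
  pathAdj? u v
  ⊎-dec ((toℕ u ≟ 0) ×-dec (suc (toℕ v) ≟ n))
  ⊎-dec ((toℕ v ≟ 0) ×-dec (suc (toℕ u) ≟ n))

module PathNL {n} = ColorFunctions (Path n) pathAdj?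
module CycleNL {n} = ColorFunctions (Cycle n) cycleAdj?

path-below-three : ∀ m k → k < 3 → ¬ HasNLColoring (Path (3 + m)) k
path-below-three m = below-three {u = # 0} {# 2} {# 1} (inj₁ refl) (inj₂ refl) λ ()

cycle-below-three : ∀ m k → k < 3 → ¬ HasNLColoring (Cycle (3 + m)) k
cycle-below-three m = below-three {u = # 0} {# 2} {# 1} (inj₁ (inj₁ refl)) (inj₁ (inj₂ refl)) λ ()

even-cycle-below-four : ∀ m → {False (CycleNL.hasNLColoring? {3 + m} {3})}
  → ∀ k → k < 4 → ¬ HasNLColoring (Cycle (3 + m)) k
even-cycle-below-four m {no3} =
  below-suc (cycle-below-three m) (toWitnessFalse no3)

path-2-χNL : χNL≡ (Path 2) 2
path-2-χNL = PathNL.nlColoring (# 0 ∷ # 1 ∷ [])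
           , λ k k<2 (c , _) → no-coloring-below-two {u = # 0} {# 1} (inj₁ refl) k k<2 c

path-χNL : ∀ n → 3 ≤ n → n ≤ 9 → χNL≡ (Path n) 3
path-χNL 0 ()
path-χNL 1 (s≤s ())
path-χNL 2 (s≤s (s≤s ()))
path-χNL 3 _ _ = PathNL.nlColoring (# 0 ∷ # 1 ∷ # 2 ∷ []) , path-below-three 0
path-χNL 4 _ _ = PathNL.nlColoring (# 0 ∷ # 1 ∷ # 0 ∷ # 2 ∷ []) , path-below-three 1
path-χNL 5 _ _ =
  PathNL.nlColoring (# 0 ∷ # 1 ∷ # 0 ∷ # 2 ∷ # 0 ∷ []) , path-below-three 2
path-χNL 6 _ _ =
  PathNL.nlColoring (# 0 ∷ # 1 ∷ # 0 ∷ # 2 ∷ # 1 ∷ # 2 ∷ []) , path-below-three 3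
path-χNL 7 _ _ =
  PathNL.nlColoring (# 0 ∷ # 1 ∷ # 0 ∷ # 2 ∷ # 0 ∷ # 2 ∷ # 1 ∷ []) , path-below-three 4
path-χNL 8 _ _ =
  PathNL.nlColoring (# 0 ∷ # 1 ∷ # 0 ∷ # 2 ∷ # 0 ∷ # 2 ∷ # 1 ∷ # 2 ∷ []) , path-below-three 5
path-χNL 9 _ _ =
  PathNL.nlColoring (# 0 ∷ # 1 ∷ # 2 ∷ # 1 ∷ # 2 ∷ # 0 ∷ # 2 ∷ # 0 ∷ # 1 ∷ []) , path-below-three 6
path-χNL (suc (suc (suc (suc (suc (suc (suc (suc (suc (suc _)))))))))) _
  (s≤s (s≤s (s≤s (s≤s (s≤s (s≤s (s≤s (s≤s (s≤s ())))))))))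

odd-cycle-χNL : ∀ n → (n ≡ 3 ⊎ n ≡ 5 ⊎ n ≡ 7 ⊎ n ≡ 9) → χNL≡ (Cycle n) 3
odd-cycle-χNL _ (inj₁ refl) =
  CycleNL.nlColoring (# 0 ∷ # 1 ∷ # 2 ∷ []) , cycle-below-three 0
odd-cycle-χNL _ (inj₂ (inj₁ refl)) =
  CycleNL.nlColoring (# 0 ∷ # 1 ∷ # 0 ∷ # 1 ∷ # 2 ∷ []) , cycle-below-three 2
odd-cycle-χNL _ (inj₂ (inj₂ (inj₁ refl))) =
  CycleNL.nlColoring (# 0 ∷ # 1 ∷ # 0 ∷ # 1 ∷ # 2 ∷ # 0 ∷ # 2 ∷ []) , cycle-below-three 4
odd-cycle-χNL _ (inj₂ (inj₂ (inj₂ refl))) =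
  CycleNL.nlColoring (# 0 ∷ # 1 ∷ # 0 ∷ # 1 ∷ # 2 ∷ # 1 ∷ # 2 ∷ # 0 ∷ # 2 ∷ [])
  , cycle-below-three 6

even-cycle-χNL : ∀ n → (n ≡ 4 ⊎ n ≡ 6 ⊎ n ≡ 8) → χNL≡ (Cycle n) 4
even-cycle-χNL _ (inj₁ refl) =
  CycleNL.nlColoring (# 0 ∷ # 1 ∷ # 2 ∷ # 3 ∷ []) , even-cycle-below-four 1
even-cycle-χNL _ (inj₂ (inj₁ refl)) =
  CycleNL.nlColoring (# 0 ∷ # 1 ∷ # 0 ∷ # 1 ∷ # 2 ∷ # 3 ∷ []) , even-cycle-below-four 3
even-cycle-χNL _ (inj₂ (inj₂ refl)) =
  CycleNL.nlColoring (# 0 ∷ # 1 ∷ # 0 ∷ # 1 ∷ # 2 ∷ # 0 ∷ # 1 ∷ # 3 ∷ [])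
  , even-cycle-below-four 5

theorem7 :
    χNL≡ (Path 2) 2
    × (∀ n → 3 ≤ n → n ≤ 9 → χNL≡ (Path n) 3)
    × (∀ n → (n ≡ 3 ⊎ n ≡ 5 ⊎ n ≡ 7 ⊎ n ≡ 9) → χNL≡ (Cycle n) 3)
    × (∀ n → (n ≡ 4 ⊎ n ≡ 6 ⊎ n ≡ 8) → χNL≡ (Cycle n) 4)
theorem7 = path-2-χNL , path-χNL , odd-cycle-χNL , even-cycle-χNL
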